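{- Let $\mathbb{F}_q$ be a finite field of characteristic $p$. Let $A,B\in\mathbb{F}_q[x]$ be additive polynomials and let $g\in\mathbb{F}_q[x]$ be arbitrary, and put $f(x):=A(x)+g(B(x))$. Let $\hat B\in\mathbb{F}_q[x]$ be any polynomial such that $B(\hat B(\gamma))=\gamma$ for every $\gamma\in\operatorname{im}B$, and put $\hat f(x):=g(x)+A(\hat B(x))$. Then $f$ permutes $\mathbb{F}_q$ if and only if $A(\ker B)+\hat f(\operatorname{im}B)=\mathbb{F}_q$. Equivalently, $f$ permutes $\mathbb{F}_q$ if and only if $\hat f$ induces a bijection from $\operatorname{im}B$ to the quotient group $\mathbb{F}_q/A(\ker B)$ of the additive group of $\mathbb{F}_q$ by the subgroup $A(\ker B)$.
   Context: An additive polynomial over $\mathbb{F}_q$ (of characteristic $p$) is a polynomial of the form $\sum_{i=0}^k a_i x^{p^i}$ with $a_i\in\mathbb{F}_q$; it induces a homomorphism of the additive group of $\mathbb{F}_q$. For a polynomial $B$, $\operatorname{im}B$ and $\ker B$ denote the image and kernel of the induced map $\mathbb{F}_q\to\mathbb{F}_q$. A polynomial permutes $\mathbb{F}_q$ if it induces a bijection $\mathbb{F}_q\to\mathbb{F}_q$. For subsets $S,T\subseteq\mathbb{F}_q$, $S+T=\{s+t: s\in S, t\in T\}$. -}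

module Defs where

open import Level using (Level; suc; _⊔_) renaming (zero to lzero)
open import Data.Nat as ℕ using (ℕ; zero) renaming (suc to sucℕ)
open import Data.Nat.Primality using (Prime)
open import Data.Fin using (Fin)
open import Data.List using (List; []; _∷_)
open import Data.Product using (Σ; ∃; _×_; _,_)
open import Relation.Nullary using (¬_)
open import Relation.Binary.PropositionalEquality using (_≡_)
open import Function.Bundles using (_↔_)
open import Function.Definitions using (Bijective)

record FiniteField (q : ℕ) : Set₁ where
  infixl 6 _+_ _-_
  infixl 7 _*_
  field
    Carrier  : Set
    _+_ _*_  : Carrier → Carrier → Carrier
    -_       : Carrier → Carrier
    0# 1#    : Carrier
    inv      : Carrier → Carrier
    +-assoc  : ∀ x y z → (x + y) + z ≡ x + (y + z)
    +-comm   : ∀ x y → x + y ≡ y + x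
    +-identityˡ : ∀ x → 0# + x ≡ x
    -‿inverseˡ  : ∀ x → (- x) + x ≡ 0#
    *-assoc  : ∀ x y z → (x * y) * z ≡ x * (y * z)
    *-comm   : ∀ x y → x * y ≡ y * x
    *-identityˡ : ∀ x → 1# * x ≡ x
    distribˡ : ∀ x y z → x * (y + z) ≡ (x * y) + (x * z)
    0≢1      : ¬ (0# ≡ 1#)
    inv-inverseˡ : ∀ x → ¬ (x ≡ 0#) → inv x * x ≡ 1#
    enumeration : Fin q ↔ Carrier

  _-_ : Carrier → Carrier → Carrier
  x - y = x + (- y)

  natCast : ℕ → Carrier
  natCast zero     = 0#
  natCast (sucℕ n) = 1# + natCast n

  _^_ : Carrier → ℕ → Carrier
  x ^ zero     = 1#
  x ^ sucℕ n   = x * (x ^ n)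

  HasCharacteristic : ℕ → Set
  HasCharacteristic p = Prime p × natCast p ≡ 0#

  -- Polynomials in F[x] given by coefficient lists (constant term first);
  -- evaluation by Horner's rule.
  Poly : Set
  Poly = List Carrier

  eval : Poly → Carrier → Carrier
  eval []       x = 0#
  eval (c ∷ cs) x = c + x * eval cs x

  -- Additive polynomial Σ_{i} a_i x^{p^i}, given by its coefficient
  -- list (a_0, a_1, ..., a_k); evalAdd p a x evaluates it at x.
  evalAddFrom : ℕ → ℕ → List Carrier → Carrier → Carrier
  evalAddFrom p i []       x = 0#
  evalAddFrom p i (a ∷ as) x = a * (x ^ (p ℕ.^ i)) + evalAddFrom p (sucℕ i) as x

  evalAdd : ℕ → List Carrier → Carrier → Carrier
  evalAdd p a x = evalAddFrom p 0 a x

  Subset : Set₁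
  Subset = Carrier → Set

  im : (Carrier → Carrier) → Subset
  im h γ = ∃ λ x → h x ≡ γ

  ker : (Carrier → Carrier) → Subset
  ker h x = h x ≡ 0#

  _⟨_⟩ : (Carrier → Carrier) → Subset → Subset
  h ⟨ S ⟩ = λ y → ∃ λ x → S x × h x ≡ y

  _+ₛ_ : Subset → Subset → Subset
  S +ₛ T = λ y → ∃ λ s → ∃ λ t → S s × T t × s + t ≡ y

  IsWhole : Subset → Set
  IsWhole S = ∀ y → S y

  Permutes : (Carrier → Carrier) → Set
  Permutes h = Bijective _≡_ _≡_ h

  -- h induces a bijection from S to the quotient group F / H
  -- (H an additive subgroup), i.e. the map s ↦ h s + H is
  -- injective on S and every coset of H is hit by some s ∈ S.
  InducesBijectionToQuotient : (Carrier → Carrier) → Subset → Subset → Set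
  InducesBijectionToQuotient h S H =
    (∀ s₁ s₂ → S s₁ → S s₂ → H (h s₁ - h s₂) → s₁ ≡ s₂)
    × (∀ y → ∃ λ s → S s × H (y - h s))

{-# OPTIONS --safe #-}
-- Every x splits as k + B̂ (B x) with k = x − B̂ (B x) ∈ ker B, and for k ∈ ker B, γ ∈ im B
-- additivity gives f (k + B̂ γ) = A k + f̂ γ.  Hence the image of f is exactly
-- A(ker B) + f̂(im B), and on a finite field f permutes iff it is onto.  Injectivity of
-- f also forces injectivity of f̂ modulo A(ker B), since B recovers γ from k + B̂ γ.
-- Additivity of A and B is the Frobenius identity (x + y)ᵖ = xᵖ + yᵖ, which holds
-- because p divides the inner binomial coefficients.
module Submission where

open import Defs
open import Data.Nat using (ℕ)
open import Data.List using (List)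
open import Data.Product using (_×_)
open import Function.Bundles using (_⇔_)
open import Relation.Binary.PropositionalEquality using (_≡_)

open import Data.Nat as ℕ using (zero; suc; _∸_; _<_; _!; s<s; z<s)
open import Data.Nat.Properties using (_!*_!≢0; n∸n≡0; <⇒≱; <⇒≤; n<1+n; m≤n⇒m≤1+n; ∸-monoʳ-<)
open import Data.Nat.Divisibility using (_∣_; divides; ∣⇒≤; ∣1⇒≡1; m∣m*n)
open import Data.Nat.DivMod using (m/n*n≡m)
open import Data.Nat.Primality using (Prime; prime; euclidsLemma; ¬prime[0])
open import Data.Nat.Combinatorics using (_C_; nCn≡1; nCk≡n!/k![n-k]!; k![n∸k]!∣n!)
open import Data.Fin using (Fin; zero; suc; fromℕ)
open import Data.Fin.Properties using (pigeonhole; <-irrefl; inject₁ℕ<; toℕ-fromℕ)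
open import Data.List using ([]; _∷_)
open import Data.Product using (∃; _,_; proj₁; proj₂)
open import Data.Sum using (inj₁; inj₂)
open import Function.Base using (_∘_)
open import Function.Bundles using (_↔_; Inverse; Injection; Equivalence; mk⇔)
open import Function.Definitions using (Injective; StrictlySurjective; Bijective)
open import Function.Properties.Inverse using (↔⇒↣; ↔-sym)
open import Function.Consequences.Propositional
  using (surjective⇒strictlySurjective; strictlySurjective⇒surjective)
open import Algebra.Bundles using (CommutativeSemiring; CommutativeRing)
open import Relation.Nullary.Negation using (contradiction)
import Relation.Binary.PropositionalEquality as ≡

p∣m!⇒p≤m : ∀ {p} → Prime p → ∀ m → p ∣ m ! → p ℕ.≤ m
p∣m!⇒p≤m (prime _) zero p∣1 = contradiction (∣1⇒≡1 p∣1) ℕ.nonTrivial⇒≢1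
p∣m!⇒p≤m p-prime (suc m) p∣m!
  with euclidsLemma (suc m) (m !) p-prime p∣m!
... | inj₁ p∣1+m = ∣⇒≤ p∣1+m
... | inj₂ p∣m! = m≤n⇒m≤1+n (p∣m!⇒p≤m p-prime m p∣m!)

-- p divides p! = (p C k) * k! * (p ∸ k)!, but neither k! nor (p ∸ k)!.
p∣pCk : ∀ {p k} → Prime p → 0 < k → k < p → p ∣ p C k
p∣pCk {p@(suc p-1)} {k} p-prime 0<k k<p
  with euclidsLemma (p C k) (k ! ℕ.* (p ∸ k) !) p-prime p∣pCk*k!*[p∸k]!
  where
  instance _ = k !* (p ∸ k) !≢0
  p∣pCk*k!*[p∸k]! : p ∣ (p C k) ℕ.* (k ! ℕ.* (p ∸ k) !)
  p∣pCk*k!*[p∸k]! rewrite nCk≡n!/k![n-k]! (<⇒≤ k<p) | m/n*n≡m (k![n∸k]!∣n! (<⇒≤ k<p)) =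
    m∣m*n (p-1 !)
... | inj₁ p∣pCk = p∣pCk
... | inj₂ p∣k!*[p∸k]! with euclidsLemma (k !) ((p ∸ k) !) p-prime p∣k!*[p∸k]!
...   | inj₁ p∣k! = contradiction (p∣m!⇒p≤m p-prime k p∣k!) (<⇒≱ k<p)
...   | inj₂ p∣[p∸k]! =
  contradiction (p∣m!⇒p≤m p-prime (p ∸ k) p∣[p∸k]!) (<⇒≱ (∸-monoʳ-< 0<k (<⇒≤ k<p)))

strictlySurjective⇒bijective : ∀ {a n} {A : Set a} → Fin n ↔ A → {f : A → A} →
                               StrictlySurjective _≡_ f → Bijective _≡_ _≡_ f
strictlySurjective⇒bijective {n = n} {A} enumeration {f} surj =
  f-injective , strictlySurjective⇒surjective surj
  where
  open ≡ using (sym; trans; cong)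
  open ≡.≡-Reasoning
  open Inverse enumeration using (to; from)

  s : A → A
  s = proj₁ ∘ surj

  f∘s≗id : ∀ y → f (s y) ≡ y
  f∘s≗id = proj₂ ∘ surj

  to-injective : Injective _≡_ _≡_ to
  to-injective = Injection.injective (↔⇒↣ enumeration)

  from-injective : Injective _≡_ _≡_ from
  from-injective = Injection.injective (↔⇒↣ (↔-sym enumeration))

  s-injective : Injective _≡_ _≡_ s
  s-injective {y₁} {y₂} e = trans (sym (f∘s≗id y₁)) (trans (cong f e) (f∘s≗id y₂))

  -- Two of these n + 1 points coincide; as s is injective, x lies in the image of s,
  -- on which s ∘ f is the identity.
  x-and-image-of-s : A → Fin (suc n) → A
  x-and-image-of-s x zero    = x
  x-and-image-of-s x (suc i) = s (to i)

  s∘f≗id : ∀ x → s (f x) ≡ x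
  s∘f≗id x with pigeonhole (n<1+n n) (from ∘ x-and-image-of-s x)
  ... | zero  , suc j , _   , e =
    let x≡s[to-j] = from-injective e
    in trans (cong (s ∘ f) x≡s[to-j]) (trans (cong s (f∘s≗id (to j))) (sym x≡s[to-j]))
  ... | suc i , suc j , i<j , e =
    contradiction i<j (<-irrefl (cong suc (to-injective (s-injective (from-injective e)))))

  f-injective : Injective _≡_ _≡_ f
  f-injective {x} {y} fx≡fy = begin
    x         ≡⟨ s∘f≗id x ⟨
    s (f x)   ≡⟨ cong s fx≡fy ⟩
    s (f y)   ≡⟨ s∘f≗id y ⟩
    y         ∎

module Frobenius {c ℓ} (S : CommutativeSemiring c ℓ) where
  open CommutativeSemiring S hiding (zero)
  open import Algebra.Properties.Semiring.Mult semiring using (×-congʳ; ×-assoc-*; ×1-homo-*)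
    renaming (_×_ to _·_)
  open import Algebra.Properties.Semiring.Exp semiring using (_^_; ^-congˡ; ^-assocʳ)
  open import Algebra.Properties.Semiring.Sum semiring using (sum; sum-init-last; sum-cong-≋; sum-replicate-zero)
  open import Algebra.Properties.CommutativeSemiring.Binomial S using (binomialTerm; theorem)
  open import Relation.Binary.Reasoning.Setoid setoid
  open import Data.Vec.Functional using (init; last)

  p∣n⇒n·x≈0 : ∀ {p n} → p · 1# ≈ 0# → p ∣ n → ∀ x → n · x ≈ 0#
  p∣n⇒n·x≈0 {p} char-p (divides m ≡.refl) x = begin
    (m ℕ.* p) · x             ≈⟨ ×-congʳ (m ℕ.* p) (*-identityˡ x) ⟨
    (m ℕ.* p) · (1# * x)      ≈⟨ ×-assoc-* (m ℕ.* p) 1# x ⟨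
    ((m ℕ.* p) · 1#) * x      ≈⟨ *-congʳ (×1-homo-* m p) ⟩
    ((m · 1#) * (p · 1#)) * x ≈⟨ *-congʳ (*-congˡ char-p) ⟩
    ((m · 1#) * 0#) * x       ≈⟨ *-congʳ (zeroʳ (m · 1#)) ⟩
    0# * x                    ≈⟨ zeroˡ x ⟩
    0#                        ∎

  binomialTerm-last : ∀ x y n → binomialTerm x y n (fromℕ n) ≈ x ^ n
  binomialTerm-last x y n rewrite toℕ-fromℕ n | nCn≡1 n | n∸n≡0 n =
    trans (+-identityʳ _) (*-identityʳ (x ^ n))

  frobenius : ∀ {p} → Prime p → p · 1# ≈ 0# → ∀ x y → (x + y) ^ p ≈ x ^ p + y ^ p
  frobenius {zero}  p-prime = contradiction p-prime ¬prime[0]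
  frobenius {suc m} p-prime char-p x y = begin
    (x + y) ^ p                                       ≈⟨ theorem p x y ⟩
    t zero + sum (t ∘ suc)                            ≈⟨ +-congˡ (sum-init-last (t ∘ suc)) ⟩
    t zero + (sum (init (t ∘ suc)) + last (t ∘ suc))
      ≈⟨ +-cong t₀≈y^p (+-cong inner-sum≈0 (binomialTerm-last x y p)) ⟩
    y ^ p + (0# + x ^ p)                              ≈⟨ +-congˡ (+-identityˡ (x ^ p)) ⟩
    y ^ p + x ^ p                                     ≈⟨ +-comm (y ^ p) (x ^ p) ⟩
    x ^ p + y ^ p                                     ∎
    where
    p = suc m
    t = binomialTerm x y p

    t₀≈y^p : t zero ≈ y ^ p
    t₀≈y^p = trans (+-identityʳ _) (*-identityˡ (y ^ p))

    inner-sum≈0 : sum (init (t ∘ suc)) ≈ 0#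
    inner-sum≈0 = trans (sum-cong-≋ inner-term≈0) (sum-replicate-zero m)
      where
      inner-term≈0 : ∀ i → init (t ∘ suc) i ≈ 0#
      inner-term≈0 i = p∣n⇒n·x≈0 char-p (p∣pCk p-prime z<s (s<s (inject₁ℕ< i))) _

  frobenius-iterate : ∀ {p} → Prime p → p · 1# ≈ 0# →
                      ∀ i x y → (x + y) ^ (p ℕ.^ i) ≈ x ^ (p ℕ.^ i) + y ^ (p ℕ.^ i)
  frobenius-iterate p-prime char-p zero    x y =
    trans (*-identityʳ (x + y)) (sym (+-cong (*-identityʳ x) (*-identityʳ y)))
  frobenius-iterate {p} p-prime char-p (suc i) x y = begin
    (x + y) ^ (p ℕ.* p ℕ.^ i)                 ≈⟨ ^-assocʳ (x + y) p (p ℕ.^ i) ⟨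
    ((x + y) ^ p) ^ (p ℕ.^ i)                 ≈⟨ ^-congˡ (p ℕ.^ i) (frobenius p-prime char-p x y) ⟩
    (x ^ p + y ^ p) ^ (p ℕ.^ i)               ≈⟨ frobenius-iterate p-prime char-p i (x ^ p) (y ^ p) ⟩
    (x ^ p) ^ (p ℕ.^ i) + (y ^ p) ^ (p ℕ.^ i)
      ≈⟨ +-cong (^-assocʳ x p (p ℕ.^ i)) (^-assocʳ y p (p ℕ.^ i)) ⟩
    x ^ (p ℕ.* p ℕ.^ i) + y ^ (p ℕ.* p ℕ.^ i) ∎

module FiniteFieldProperties {q} (F : FiniteField q) where
  open FiniteField F
  open ≡ using (refl; sym; trans; cong; cong₂)
  open ≡.≡-Reasoning
  open import Algebra.Consequences.Propositional {A = Carrier}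
    using (comm∧idˡ⇒id; comm∧invˡ⇒inv; comm∧distrˡ⇒distrʳ; comm∧assoc⇒middleFour)

  commutativeRing : CommutativeRing _ _
  commutativeRing = record
    { isCommutativeRing = record
      { isRing = record
        { +-isAbelianGroup = record
          { isGroup = record
            { isMonoid = record
              { isSemigroup = record
                { isMagma = record { isEquivalence = ≡.isEquivalence ; ∙-cong = cong₂ _+_ }
                ; assoc = +-assoc
                }
              ; identity = comm∧idˡ⇒id +-comm +-identityˡ
              }
            ; inverse = comm∧invˡ⇒inv +-comm -‿inverseˡ
            ; ⁻¹-cong = cong (-_)
            }
          ; comm = +-comm
          }
        ; *-cong = cong₂ _*_
        ; *-assoc = *-assoc
        ; *-identity = comm∧idˡ⇒id *-comm *-identityˡ
        ; distrib = distribˡ , comm∧distrˡ⇒distrʳ *-comm distribˡ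
        }
      ; *-comm = *-comm
      }
    }

  open CommutativeRing commutativeRing using (semiring; commutativeSemiring)
  open import Algebra.Properties.Semiring.Exp semiring using () renaming (_^_ to _^ᴿ_)
  open import Algebra.Properties.Semiring.Mult semiring using () renaming (_×_ to _·_)
  open Frobenius commutativeSemiring using (frobenius-iterate)

  ^≗^ᴿ : ∀ x n → x ^ n ≡ x ^ᴿ n
  ^≗^ᴿ x zero    = refl
  ^≗^ᴿ x (suc n) = cong (x *_) (^≗^ᴿ x n)

  natCast≗·1 : ∀ n → natCast n ≡ n · 1#
  natCast≗·1 zero    = refl
  natCast≗·1 (suc n) = cong (1# +_) (natCast≗·1 n)

  Additive : (Carrier → Carrier) → Set
  Additive h = ∀ x y → h (x + y) ≡ h x + h y

  0-additive : Additive (λ _ → 0#)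
  0-additive x y = sym (+-identityˡ 0#)

  *-additive : ∀ a {h} → Additive h → Additive (λ x → a * h x)
  *-additive a {h} h-additive x y = trans (cong (a *_) (h-additive x y)) (distribˡ a (h x) (h y))

  +-additive : ∀ {h₁ h₂} → Additive h₁ → Additive h₂ → Additive (λ x → h₁ x + h₂ x)
  +-additive {h₁} {h₂} h₁-additive h₂-additive x y =
    trans (cong₂ _+_ (h₁-additive x y) (h₂-additive x y))
          (comm∧assoc⇒middleFour +-comm +-assoc (h₁ x) (h₁ y) (h₂ x) (h₂ y))

  ^p^i-additive : ∀ {p} → HasCharacteristic p → ∀ i → Additive (_^ (p ℕ.^ i))
  ^p^i-additive {p} (p-prime , char-p) i x y = begin
    (x + y) ^ pⁱ      ≡⟨ ^≗^ᴿ (x + y) pⁱ ⟩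
    (x + y) ^ᴿ pⁱ     ≡⟨ frobenius-iterate p-prime (trans (sym (natCast≗·1 p)) char-p) i x y ⟩
    x ^ᴿ pⁱ + y ^ᴿ pⁱ ≡⟨ sym (cong₂ _+_ (^≗^ᴿ x pⁱ) (^≗^ᴿ y pⁱ)) ⟩
    x ^ pⁱ + y ^ pⁱ   ∎
    where pⁱ = p ℕ.^ i

  evalAddFrom-additive : ∀ {p} → HasCharacteristic p → ∀ i as → Additive (evalAddFrom p i as)
  evalAddFrom-additive char-p i []       = 0-additive
  evalAddFrom-additive char-p i (a ∷ as) =
    +-additive (*-additive a (^p^i-additive char-p i)) (evalAddFrom-additive char-p (suc i) as)

  open import Algebra.Properties.Group (CommutativeRing.+-group commutativeRing)
    using (identityˡ-unique; //-rightDividesˡ; //-rightDividesʳ)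

  module Decomposition (A B : Carrier → Carrier) (A-additive : Additive A) (B-additive : Additive B)
                       (g B̂ : Carrier → Carrier) (B∘B̂≗id : ∀ γ → im B γ → B (B̂ γ) ≡ γ) where

    f f̂ : Carrier → Carrier
    f x = A x + g (B x)
    f̂ γ = g γ + A (B̂ γ)

    A[kerB]+f̂[imB] : Subset
    A[kerB]+f̂[imB] = (A ⟨ ker B ⟩) +ₛ (f̂ ⟨ im B ⟩)

    f̂[imB]-meets-every-coset : Set
    f̂[imB]-meets-every-coset = ∀ y → ∃ λ s → im B s × (A ⟨ ker B ⟩) (y - f̂ s)

    x-B̂Bx∈kerB : ∀ x → ker B (x - B̂ (B x))
    x-B̂Bx∈kerB x = identityˡ-unique (B (x - y)) (B x) (begin
      B (x - y) + B x  ≡⟨ cong (B (x - y) +_) (B∘B̂≗id (B x) (x , refl)) ⟨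
      B (x - y) + B y  ≡⟨ B-additive (x - y) y ⟨
      B ((x - y) + y)  ≡⟨ cong B (//-rightDividesˡ y x) ⟩
      B x              ∎)
      where y = B̂ (B x)

    B[k+B̂γ]≡γ : ∀ {k γ} → ker B k → im B γ → B (k + B̂ γ) ≡ γ
    B[k+B̂γ]≡γ {k} {γ} k∈kerB γ∈imB = begin
      B (k + B̂ γ)    ≡⟨ B-additive k (B̂ γ) ⟩
      B k + B (B̂ γ)  ≡⟨ cong₂ _+_ k∈kerB (B∘B̂≗id γ γ∈imB) ⟩
      0# + γ         ≡⟨ +-identityˡ γ ⟩
      γ              ∎

    f∘B̂≡f̂ : ∀ {γ} → im B γ → f (B̂ γ) ≡ f̂ γ
    f∘B̂≡f̂ {γ} γ∈imB =
      trans (cong (λ β → A (B̂ γ) + g β) (B∘B̂≗id γ γ∈imB)) (+-comm (A (B̂ γ)) (g γ))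

    f[k+B̂γ]≡Ak+f̂γ : ∀ {k γ} → ker B k → im B γ → f (k + B̂ γ) ≡ A k + f̂ γ
    f[k+B̂γ]≡Ak+f̂γ {k} {γ} k∈kerB γ∈imB = begin
      A (k + B̂ γ) + g (B (k + B̂ γ))
        ≡⟨ cong₂ _+_ (A-additive k (B̂ γ)) (cong g (B[k+B̂γ]≡γ k∈kerB γ∈imB)) ⟩
      (A k + A (B̂ γ)) + g γ          ≡⟨ +-assoc (A k) (A (B̂ γ)) (g γ) ⟩
      A k + (A (B̂ γ) + g γ)          ≡⟨ cong (A k +_) (+-comm (A (B̂ γ)) (g γ)) ⟩
      A k + f̂ γ                      ∎

    f≡A[x-B̂Bx]+f̂Bx : ∀ x → f x ≡ A (x - B̂ (B x)) + f̂ (B x)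
    f≡A[x-B̂Bx]+f̂Bx x = trans (cong f (sym (//-rightDividesˡ (B̂ (B x)) x)))
                              (f[k+B̂γ]≡Ak+f̂γ (x-B̂Bx∈kerB x) (x , refl))

    im-f⊆sumset : ∀ {y} → im f y → A[kerB]+f̂[imB] y
    im-f⊆sumset (x , refl) =
      _ , _ , (x - B̂ (B x) , x-B̂Bx∈kerB x , refl) , (B x , (x , refl) , refl) , sym (f≡A[x-B̂Bx]+f̂Bx x)

    sumset⊆im-f : ∀ {y} → A[kerB]+f̂[imB] y → im f y
    sumset⊆im-f (_ , _ , (k , k∈kerB , refl) , (γ , γ∈imB , refl) , refl) =
      k + B̂ γ , f[k+B̂γ]≡Ak+f̂γ k∈kerB γ∈imB

    permutes⇔sumset-whole : Permutes f ⇔ IsWhole A[kerB]+f̂[imB]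
    permutes⇔sumset-whole = mk⇔
      (λ (_ , f-surjective) → im-f⊆sumset ∘ surjective⇒strictlySurjective f-surjective)
      (λ whole → strictlySurjective⇒bijective enumeration (sumset⊆im-f ∘ whole))

    injective⇒f̂-injective-modulo : Injective _≡_ _≡_ f → ∀ s₁ s₂ → im B s₁ → im B s₂ →
                                   (A ⟨ ker B ⟩) (f̂ s₁ - f̂ s₂) → s₁ ≡ s₂
    injective⇒f̂-injective-modulo f-injective s₁ s₂ s₁∈imB s₂∈imB (k , k∈kerB , Ak≡f̂s₁-f̂s₂) = begin
      s₁            ≡⟨ B∘B̂≗id s₁ s₁∈imB ⟨
      B (B̂ s₁)      ≡⟨ cong B (f-injective f[B̂s₁]≡f[k+B̂s₂]) ⟩
      B (k + B̂ s₂)  ≡⟨ B[k+B̂γ]≡γ k∈kerB s₂∈imB ⟩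
      s₂            ∎
      where
      f[B̂s₁]≡f[k+B̂s₂] : f (B̂ s₁) ≡ f (k + B̂ s₂)
      f[B̂s₁]≡f[k+B̂s₂] = begin
        f (B̂ s₁)                 ≡⟨ f∘B̂≡f̂ s₁∈imB ⟩
        f̂ s₁                     ≡⟨ //-rightDividesˡ (f̂ s₂) (f̂ s₁) ⟨
        (f̂ s₁ - f̂ s₂) + f̂ s₂     ≡⟨ cong (_+ f̂ s₂) Ak≡f̂s₁-f̂s₂ ⟨
        A k + f̂ s₂               ≡⟨ f[k+B̂γ]≡Ak+f̂γ k∈kerB s₂∈imB ⟨
        f (k + B̂ s₂)             ∎

    sumset-whole⇔f̂[imB]-meets-every-coset :
      IsWhole A[kerB]+f̂[imB] ⇔ f̂[imB]-meets-every-coset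
    sumset-whole⇔f̂[imB]-meets-every-coset = mk⇔ to from
      where
      to : IsWhole A[kerB]+f̂[imB] → f̂[imB]-meets-every-coset
      to whole y with whole y
      ... | a , _ , (k , k∈kerB , Ak≡a) , (γ , γ∈imB , refl) , refl =
        γ , γ∈imB , k , k∈kerB , trans Ak≡a (sym (//-rightDividesʳ (f̂ γ) a))
      from : f̂[imB]-meets-every-coset → IsWhole A[kerB]+f̂[imB]
      from surjective y with surjective y
      ... | s , s∈imB , y-f̂s∈AkerB =
        y - f̂ s , f̂ s , y-f̂s∈AkerB , (s , s∈imB , refl) , //-rightDividesˡ (f̂ s) y

    permutes⇔inducesBijectionToQuotient : Permutes f ⇔ InducesBijectionToQuotient f̂ (im B) (A ⟨ ker B ⟩)
    permutes⇔inducesBijectionToQuotient = mk⇔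
      (λ f-permutes@(f-injective , _) →
        injective⇒f̂-injective-modulo f-injective ,
        to sumset-whole⇔f̂[imB]-meets-every-coset (to permutes⇔sumset-whole f-permutes))
      (λ (_ , meets-every-coset) →
        from permutes⇔sumset-whole (from sumset-whole⇔f̂[imB]-meets-every-coset meets-every-coset))
      where open Equivalence using (to; from)

proposition3p1 : (q p : ℕ) (F : FiniteField q) → FiniteField.HasCharacteristic F p →
    let open FiniteField F in
    (a b : List Carrier) (g B̂ : Poly) →
    (∀ γ → im (evalAdd p b) γ → evalAdd p b (eval B̂ γ) ≡ γ) →
    let A = evalAdd p a
        B = evalAdd p b
        f = λ x → A x + eval g (B x)
        f̂ = λ x → eval g x + A (eval B̂ x)
    in (Permutes f ⇔ IsWhole ((A ⟨ ker B ⟩) +ₛ (f̂ ⟨ im B ⟩)))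
       × (Permutes f ⇔ InducesBijectionToQuotient f̂ (im B) (A ⟨ ker B ⟩))
proposition3p1 q p F char-p a b g B̂ B∘B̂≗id = permutes⇔sumset-whole , permutes⇔inducesBijectionToQuotient
  where
  open FiniteField F using (eval; evalAdd)
  open FiniteFieldProperties F using (evalAddFrom-additive; module Decomposition)
  open Decomposition (evalAdd p a) (evalAdd p b)
                     (evalAddFrom-additive char-p 0 a) (evalAddFrom-additive char-p 0 b)
                     (eval g) (eval B̂) B∘B̂≗id
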